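{- For every positive integer $n$, $T(n)\leq\binom{n}{\lfloor n/2\rfloor}$.
   Context: For a vector $A=(a_1,\ldots,a_k)$, $k\geq 1$, of positive integers define $f(A)$ recursively by $f(a_1)=a_1$ and $f(a_1,\ldots,a_{i+1})=(f(a_1,\ldots,a_i)+1)\,a_{i+1}$. For a positive integer $n$, $T(n)$ is the number of vectors $A$ (of any length $k\geq1$, with positive integer entries) such that $f(A)=n$. -}

module Defs where

open import Data.Nat using (ℕ; _+_; _*_; _≤_)
open import Data.List using (List; foldl; length)
open import Data.List.NonEmpty using (List⁺; _∷_; toList)
open import Data.List.Relation.Unary.All using (All)
open import Data.List.Relation.Unary.Unique.Propositional using (Unique)
open import Data.Product using (_×_)
open import Relation.Binary.PropositionalEquality using (_≡_)

f : List⁺ ℕ → ℕ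
f (a ∷ as) = foldl (λ acc b → (acc + 1) * b) a as

IsRep : ℕ → List⁺ ℕ → Set
IsRep n A = All (1 ≤_) (toList A) × f A ≡ n

-- "T(n) ≤ m": every finite collection of pairwise distinct vectors A
-- with f(A) = n has at most m elements.
T≤ : ℕ → ℕ → Set
T≤ n m = (L : List (List⁺ ℕ)) → Unique L → All (IsRep n) L → length L ≤ m

module Submission where

-- A vector A with f(A) = n is either the singleton [n], or it has the form
-- P ++ [b] with b ≥ 1 and (f(P) + 1)·b = n.  When b = 1 we have f(P) = n - 1,
-- and when b ≥ 2 we have f(P) + 1 ≤ ⌊n/2⌋ and b = n / (f(P) + 1) is
-- determined by f(P).  Hence T(n) ≤ 1 + T(n-1) + Σ_{m<⌊n/2⌋} T(m).

open import Defs
open import Data.Nat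
open import Data.Nat.Properties
open import Data.Nat.DivMod using (_/_; m/n≡1+[m∸n]/n; m*n/n≡m)
open import Data.Nat.Combinatorics using (_C_; nCk+nC[k+1]≡[n+1]C[k+1]; nCk≡nC[n∸k])
open import Data.List using (List; []; _∷_; _++_; length; map)
open import Data.List.Properties using (length-++; length-map; length-++-sucʳ; foldl-∷ʳ)
open import Data.List.NonEmpty using (List⁺; [_]; _∷_; toList; _⁺∷ʳ_; snocView; _∷ʳ′_)
open import Data.List.Relation.Unary.All as All using (All; []; _∷_)
open import Data.List.Relation.Unary.All.Properties using (++⁻)
open import Data.List.Relation.Unary.Any using (here; there)
open import Data.List.Relation.Unary.AllPairs using ([]; _∷_)
open import Data.List.Relation.Unary.Unique.Propositional using (Unique)
open import Data.List.Membership.Propositional using (_∈_)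
open import Data.List.Membership.Propositional.Properties using (∈-++⁺ˡ; ∈-++⁺ʳ; ∈-map⁺; ∈-∃++)
open import Data.Product using (_×_; _,_)
open import Data.Sum using (inj₁; inj₂)
open import Relation.Nullary using (contradiction)
open import Relation.Binary.PropositionalEquality
  using (_≡_; _≢_; refl; sym; trans; cong; subst; module ≡-Reasoning)

step-monotone : (g : ℕ → ℕ) → (∀ n → g n ≤ g (suc n)) → ∀ {m n} → m ≤ n → g m ≤ g n
step-monotone g step m≤n = go (≤⇒≤′ m≤n)
  where
  go : ∀ {m n} → m ≤′ n → g m ≤ g n
  go ≤′-refl        = ≤-refl
  go (≤′-step m≤n) = ≤-trans (go m≤n) (step _)

n/2≡⌊n/2⌋ : ∀ n → n / 2 ≡ ⌊ n /2⌋
n/2≡⌊n/2⌋ zero          = refl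
n/2≡⌊n/2⌋ (suc zero)    = refl
n/2≡⌊n/2⌋ (suc (suc n)) =
  trans (m/n≡1+[m∸n]/n {suc (suc n)} {2} (s≤s (s≤s z≤n))) (cong suc (n/2≡⌊n/2⌋ n))

C-grows : ∀ n k → n C k ≤ suc n C k
C-grows n zero    = ≤-refl
C-grows n (suc k) =
  subst (n C suc k ≤_) (nCk+nC[k+1]≡[n+1]C[k+1] n k) (m≤n+m (n C suc k) (n C k))

B : ℕ → ℕ
B n = n C ⌊ n /2⌋

-- Pascal's rule at the centre: C(n+2, ⌊n/2⌋+1) = C(n+1, ⌊n/2⌋) + B (n+1),
-- where the second summand is identified with B (n+1) by symmetry.
B-pascal : ∀ n → B (suc (suc n)) ≡ suc n C ⌊ n /2⌋ + B (suc n)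
B-pascal n = begin
  suc (suc n) C suc h          ≡⟨ nCk+nC[k+1]≡[n+1]C[k+1] (suc n) h ⟨
  suc n C h + suc n C suc h    ≡⟨ cong (suc n C h +_) upper-half ⟩
  suc n C h + B (suc n)        ∎
  where
  open ≡-Reasoning
  h : ℕ
  h = ⌊ n /2⌋
  -- C(n+1, h+1) = C(n+1, n-h) and n - h = ⌈n/2⌉ = ⌊(n+1)/2⌋.
  upper-half : suc n C suc h ≡ B (suc n)
  upper-half = trans (nCk≡nC[n∸k] (s≤s (⌊n/2⌋≤n n)))
    (cong (suc n C_) (trans (cong (_∸ h) (sym (⌊n/2⌋+⌈n/2⌉≡n n))) (m+n∸m≡n h ⌈ n /2⌉)))

B-fibonacci : ∀ n → B n + B (suc n) ≤ B (suc (suc n))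
B-fibonacci n = subst (B n + B (suc n) ≤_) (sym (B-pascal n))
  (+-monoˡ-≤ (B (suc n)) (C-grows n ⌊ n /2⌋))

-- The bound on the number of representations: nothing represents 0.
β : ℕ → ℕ
β zero    = 0
β (suc n) = B (suc n)

Σβ : ℕ → ℕ
Σβ zero    = 0
Σβ (suc j) = β j + Σβ j

β-fibonacci : ∀ n → β n + β (suc n) ≤ β (suc (suc n))
β-fibonacci zero    = s≤s z≤n
β-fibonacci (suc n) = B-fibonacci (suc n)

β-monotone : ∀ {m n} → m ≤ n → β m ≤ β n
β-monotone = step-monotone β β-step
  where
  β-step : ∀ n → β n ≤ β (suc n)
  β-step zero    = z≤n
  β-step (suc n) = ≤-trans (m≤n+m (β (suc n)) (β n)) (β-fibonacci n)

-- A Fibonacci-type sequence exceeds the sum of all its earlier terms.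
Σβ<β : ∀ j → suc (Σβ j) ≤ β (suc j)
Σβ<β zero    = s≤s z≤n
Σβ<β (suc j) = begin
  suc (β j + Σβ j)        ≡⟨ +-suc (β j) (Σβ j) ⟨
  β j + suc (Σβ j)        ≤⟨ +-monoʳ-≤ (β j) (Σβ<β j) ⟩
  β j + β (suc j)         ≤⟨ β-fibonacci j ⟩
  β (suc (suc j))         ∎
  where open ≤-Reasoning

Σβ-below-odd : ∀ j → suc (Σβ (suc j)) ≤ suc (j + j) C j
Σβ-below-odd zero    = s≤s z≤n
Σβ-below-odd (suc i) = begin
  suc (Σβ (suc (suc i)))       ≤⟨ Σβ<β (suc (suc i)) ⟩
  β (3 + i)                    ≤⟨ β-monotone (s≤s (s≤s (s≤s (m≤n+m i i)))) ⟩
  β (3 + (i + i))              ≡⟨ cong (λ t → suc t C ⌈ t /2⌉) (sym (+-suc (suc i) i)) ⟩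
  B (suc (suc i + suc i))      ≡⟨ cong (suc (suc i + suc i) C_) (sym (n≡⌈n+n/2⌉ (suc i))) ⟩
  suc (suc i + suc i) C suc i  ∎
  where open ≤-Reasoning

-- β dominates the recurrence  T(k+1) ≤ 1 + T(k) + Σ_{m<⌊(k+1)/2⌋} T(m).
β-recurrence : ∀ k → suc (β k + Σβ ⌊ suc k /2⌋) ≤ β (suc k)
β-recurrence zero    = s≤s z≤n
β-recurrence (suc n) = begin
  suc (β (suc n) + Σβ (suc h))   ≡⟨ +-suc (β (suc n)) (Σβ (suc h)) ⟨
  β (suc n) + suc (Σβ (suc h))   ≤⟨ +-monoʳ-≤ (β (suc n)) tail-bound ⟩
  β (suc n) + suc n C h          ≡⟨ +-comm (β (suc n)) (suc n C h) ⟩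
  suc n C h + B (suc n)          ≡⟨ B-pascal n ⟨
  β (suc (suc n))                ∎
  where
  open ≤-Reasoning
  h : ℕ
  h = ⌊ n /2⌋
  h+h≤n : h + h ≤ n
  h+h≤n = subst (h + h ≤_) (⌊n/2⌋+⌈n/2⌉≡n n) (+-monoʳ-≤ h (⌊n/2⌋≤⌈n/2⌉ n))
  tail-bound : suc (Σβ (suc h)) ≤ suc n C h
  tail-bound = ≤-trans (Σβ-below-odd h) (step-monotone (_C h) (λ m → C-grows m h) (s≤s h+h≤n))

f-snoc : ∀ P b → f (P ⁺∷ʳ b) ≡ suc (f P) * b
f-snoc (a ∷ ys) b = trans (foldl-∷ʳ _ a b ys) (cong (_* b) (+-comm (f (a ∷ ys)) 1))

rep-snoc⁻ : ∀ {n} P b → IsRep n (P ⁺∷ʳ b) → IsRep (f P) P × 1 ≤ b × suc (f P) * b ≡ n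
rep-snoc⁻ P b (pos , fA) with ++⁻ (toList P) pos
... | posP , (b≥1 ∷ []) = (posP , refl) , b≥1 , trans (sym (f-snoc P b)) fA

-- E fuel n lists candidate vectors for n: the singleton, extensions of the
-- candidates for n-1 by 1, and extensions of the candidates for m < ⌊n/2⌋
-- by n / (m+1).  The fuel only has to exceed n.
E : (fuel n : ℕ) → List (List⁺ ℕ)
extensions : (fuel n j : ℕ) → List (List⁺ ℕ)
E zero       n       = []
E (suc fuel) zero    = []
E (suc fuel) (suc k) =
  [ suc k ] ∷ map (_⁺∷ʳ 1) (E fuel k) ++ extensions fuel (suc k) ⌊ suc k /2⌋
extensions fuel n zero    = []
extensions fuel n (suc m) = map (_⁺∷ʳ (n / suc m)) (E fuel m) ++ extensions fuel n m

length-E : ∀ fuel n → length (E fuel n) ≤ β n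
length-extensions : ∀ fuel n j → length (extensions fuel n j) ≤ Σβ j
length-E zero       n       = z≤n
length-E (suc fuel) zero    = z≤n
length-E (suc fuel) (suc k) = begin
  suc (length (map (_⁺∷ʳ 1) (E fuel k) ++ rest))
    ≡⟨ cong suc (length-++ (map (_⁺∷ʳ 1) (E fuel k))) ⟩
  suc (length (map (_⁺∷ʳ 1) (E fuel k)) + length rest)
    ≡⟨ cong (λ l → suc (l + length rest)) (length-map (_⁺∷ʳ 1) (E fuel k)) ⟩
  suc (length (E fuel k) + length rest)
    ≤⟨ s≤s (+-mono-≤ (length-E fuel k) (length-extensions fuel (suc k) ⌊ suc k /2⌋)) ⟩
  suc (β k + Σβ ⌊ suc k /2⌋)
    ≤⟨ β-recurrence k ⟩
  β (suc k) ∎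
  where
  open ≤-Reasoning
  rest : List (List⁺ ℕ)
  rest = extensions fuel (suc k) ⌊ suc k /2⌋
length-extensions fuel n zero    = z≤n
length-extensions fuel n (suc m) = begin
  length (map (_⁺∷ʳ (n / suc m)) (E fuel m) ++ extensions fuel n m)
    ≡⟨ length-++ (map (_⁺∷ʳ (n / suc m)) (E fuel m)) ⟩
  length (map (_⁺∷ʳ (n / suc m)) (E fuel m)) + length (extensions fuel n m)
    ≡⟨ cong (_+ length (extensions fuel n m)) (length-map _ (E fuel m)) ⟩
  length (E fuel m) + length (extensions fuel n m)
    ≤⟨ +-mono-≤ (length-E fuel m) (length-extensions fuel n m) ⟩
  β m + Σβ m ∎
  where open ≤-Reasoning

∈-extensions : ∀ {fuel n m j x} → m < j →
  x ∈ map (_⁺∷ʳ (n / suc m)) (E fuel m) → x ∈ extensions fuel n j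
∈-extensions {j = suc j} m<1+j x∈ with m<1+n⇒m<n∨m≡n m<1+j
... | inj₂ refl = ∈-++⁺ˡ x∈
... | inj₁ m<j  = ∈-++⁺ʳ _ (∈-extensions m<j x∈)

-- If (m+1)·b = n with b ≥ 2 then m+1 ≤ ⌊n/2⌋.
≤-half : ∀ x c → x ≤ ⌊ x * suc (suc c) /2⌋
≤-half x c = subst (_≤ ⌊ x * suc (suc c) /2⌋) (sym (n≡⌊n+n/2⌋ x)) (⌊n/2⌋-mono x+x≤)
  where
  x+x≤ : x + x ≤ x * suc (suc c)
  x+x≤ = subst (x + x ≤_) (sym (*-suc x (suc c))) (+-monoʳ-≤ x (m≤m*n x (suc c)))

extend-candidate : ∀ fuel {m P b} → P ∈ E fuel m → 1 ≤ b → P ⁺∷ʳ b ∈ E (suc fuel) (suc m * b)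
extend-candidate fuel {m} {P} {suc zero} P∈ _ =
  there (∈-++⁺ˡ (∈-map⁺ (_⁺∷ʳ 1) (subst (λ k → P ∈ E fuel k) (sym (*-identityʳ m)) P∈)))
extend-candidate fuel {m} {P} {b@(suc (suc c))} P∈ _ =
  there (∈-++⁺ʳ (map (_⁺∷ʳ 1) (E fuel (pred n)))
    (∈-extensions {fuel} {n} (≤-half (suc m) c) (subst (λ d → P ⁺∷ʳ d ∈ ext) quotient x∈)))
  where
  n : ℕ
  n = suc m * b
  ext : List (List⁺ ℕ)
  ext = map (_⁺∷ʳ (n / suc m)) (E fuel m)
  x∈ : P ⁺∷ʳ (n / suc m) ∈ ext
  x∈ = ∈-map⁺ _ P∈
  quotient : n / suc m ≡ b
  quotient = trans (cong (_/ suc m) (*-comm (suc m) b)) (m*n/n≡m b (suc m))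

complete : ∀ fuel {n A} → n < fuel → IsRep n A → A ∈ E fuel n
complete (suc fuel) {A = A} n<fuel rep with snocView A
... | [] ∷ʳ′ a with rep
...   | (s≤s _ ∷ []) , refl = here refl
complete (suc fuel) n<fuel rep | (a ∷ ys) ∷ʳ′ b
  with rep-snoc⁻ (a ∷ ys) b rep
... | repP , b≥1 , refl =
  extend-candidate fuel (complete fuel (≤-trans fP<n (≤-pred n<fuel)) repP) b≥1
  where
  fP<n : suc (f (a ∷ ys)) ≤ suc (f (a ∷ ys)) * b
  fP<n = m≤m*n (suc (f (a ∷ ys))) b {{>-nonZero b≥1}}

∈-delete : ∀ {X : Set} (us : List X) {x y vs} → x ≢ y → y ∈ us ++ x ∷ vs → y ∈ us ++ vs
∈-delete []       x≢y (here y≡x)  = contradiction (sym y≡x) x≢y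
∈-delete []       x≢y (there y∈)  = y∈
∈-delete (u ∷ us) x≢y (here y≡u)  = here y≡u
∈-delete (u ∷ us) x≢y (there y∈)  = there (∈-delete us x≢y y∈)

unique-length : ∀ {X : Set} {xs ys : List X} → Unique xs → All (_∈ ys) xs → length xs ≤ length ys
unique-length [] [] = z≤n
unique-length (x≢xs ∷ uniq) (x∈ys ∷ xs⊆ys) with ∈-∃++ x∈ys
... | us , vs , refl =
  subst (_ ≤_) (sym (length-++-sucʳ us _ vs))
    (s≤s (unique-length uniq (All.zipWith (λ (x≢y , y∈) → ∈-delete us x≢y y∈) (x≢xs , xs⊆ys))))

corollary4 : (n : ℕ) → 0 < n → T≤ n (n C (n / 2))
corollary4 (suc k) _ L uniq reps = begin
  length L                     ≤⟨ unique-length uniq (All.map (complete (suc n) (n<1+n n)) reps) ⟩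
  length (E (suc n) n)         ≤⟨ length-E (suc n) n ⟩
  B n                          ≡⟨ cong (n C_) (n/2≡⌊n/2⌋ n) ⟨
  n C (n / 2)                  ∎
  where
  open ≤-Reasoning
  n : ℕ
  n = suc k
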